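{- Let $G$ and $H$ be graphs and let $k$ be a positive integer. Then $min_k(G\square H)\leq min_k(G)\,min_k(H)$.
   Context: All graphs are finite and simple. For a positive integer $k$, the irreversible $k$-threshold conversion process on a graph proceeds as follows. Every vertex is black or white at each discrete time step $t=0,1,2,\ldots$. A black vertex stays black forever. A white vertex becomes black at time $t$ if at least $k$ of its neighbors are black at time $t-1$. A $k$-conversion set of a graph $G$ is a set $S\subseteq V(G)$ such that, if exactly the vertices of $S$ are black at time $0$, then every vertex of $G$ is eventually black. $min_k(G)$ denotes the minimum size of a $k$-conversion set of $G$. The Cartesian product $G\square H$ has vertex set $V(G)\times V(H)$. In it, $(u,u')$ and $(v,v')$ are adjacent if and only if either $u=v$ and $u'v'\in E(H)$, or $u'=v'$ and $uv\in E(G)$. -}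

module Defs where

open import Data.Nat using (ℕ; zero; suc; _*_; _≤_; _≤ᵇ_)
open import Data.Bool using (Bool; true; false; _∧_; _∨_)
open import Data.Bool.Properties using (∨-comm)
open import Data.Fin using (Fin; remQuot; _≟_)
open import Data.Empty using (⊥-elim)
open import Relation.Nullary using (yes; no)
import Data.Fin as Fin
open import Data.List using (List; length; filter; allFin)
open import Data.Product using (Σ; ∃; _×_; _,_; proj₁; proj₂)
open import Relation.Nullary.Decidable using (⌊_⌋; does)
open import Relation.Binary.PropositionalEquality using (_≡_; refl; cong₂; sym)

record Graph : Set where
  field
    n      : ℕ
    adj    : Fin n → Fin n → Bool
    adj-sym    : ∀ u v → adj u v ≡ adj v u
    adj-irrefl : ∀ v → adj v v ≡ false
open Graph public

_==_ : ∀ {m} → Fin m → Fin m → Bool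
i == j = does (i ≟ j)

==-sym : ∀ {m} (i j : Fin m) → (i == j) ≡ (j == i)
==-sym Fin.zero    Fin.zero    = refl
==-sym Fin.zero    (Fin.suc j) = refl
==-sym (Fin.suc i) Fin.zero    = refl
==-sym (Fin.suc i) (Fin.suc j) with i ≟ j | j ≟ i
... | yes _ | yes _ = refl
... | no _  | no _  = refl
... | yes p | no q  = ⊥-elim (q (sym p))
... | no p  | yes q = ⊥-elim (p (sym q))

==-refl : ∀ {m} (i : Fin m) → (i == i) ≡ true
==-refl Fin.zero = refl
==-refl (Fin.suc i) with i ≟ i
... | yes _ = refl
... | no p  = ⊥-elim (p refl)

-- Cartesian product G □ H, vertex set Fin (n G * n H) ≅ Fin (n G) × Fin (n H)
-- via Data.Fin.remQuot / combine.
×-adj : (G H : Graph) → Fin (n G) × Fin (n H) → Fin (n G) × Fin (n H) → Bool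
×-adj G H (u , u′) (v , v′) = ((u == v) ∧ adj H u′ v′) ∨ ((u′ == v′) ∧ adj G u v)

×-sym : (G H : Graph) → ∀ p q → ×-adj G H p q ≡ ×-adj G H q p
×-sym G H (u , u′) (v , v′)
  rewrite ==-sym u v | ==-sym u′ v′ | adj-sym H u′ v′ | adj-sym G u v = refl

×-irrefl : (G H : Graph) → ∀ p → ×-adj G H p p ≡ false
×-irrefl G H (u , u′)
  rewrite ==-refl u | ==-refl u′ | adj-irrefl H u′ | adj-irrefl G u = refl

□-adj : (G H : Graph) → Fin (n G * n H) → Fin (n G * n H) → Bool
□-adj G H x y = ×-adj G H (remQuot (n H) x) (remQuot (n H) y)

_□_ : Graph → Graph → Graph
G □ H = record
  { n = n G * n H
  ; adj = □-adj G H
  ; adj-sym = λ x y → ×-sym G H (remQuot (n H) x) (remQuot (n H) y)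
  ; adj-irrefl = λ x → ×-irrefl G H (remQuot (n H) x)
  }

VSet : Graph → Set
VSet G = Fin (n G) → Bool

count : ∀ {m} → (Fin m → Bool) → ℕ
count {m} P = length (filter (λ v → P v Data.Bool.≟ true) (allFin m))
  where import Data.Bool

∣_∣ : ∀ {G} → VSet G → ℕ
∣ S ∣ = count S

-- Irreversible k-threshold process: black set at time t starting from S.
black : (k : ℕ) (G : Graph) → VSet G → ℕ → VSet G
black k G S zero    v = S v
black k G S (suc t) v =
  black k G S t v ∨ (k ≤ᵇ count (λ u → adj G v u ∧ black k G S t u))

IsConversionSet : (k : ℕ) (G : Graph) → VSet G → Set
IsConversionSet k G S = ∀ v → ∃ λ t → black k G S t v ≡ true

IsMinConv : (k : ℕ) (G : Graph) → ℕ → Set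
IsMinConv k G m =
  (∃ λ (S : VSet G) → IsConversionSet k G S × ∣_∣ {G} S ≡ m)
  × (∀ (S : VSet G) → IsConversionSet k G S → m ≤ ∣_∣ {G} S)

-- If S converts G within time t and S′ converts H within time t′, then S × S′
-- converts G □ H within time t + t′.  By induction on (t, t′): when u turns
-- black in G at step t, the (at least k) black neighbours u′ of u in G give
-- black neighbours (u′, v) of (u, v) in the copy of G through v, and
-- symmetrically for steps in H.  Since |S × S′| = |S| |S′|, taking S and S′
-- minimum gives the bound.
module Submission where

open import Defs
open import Data.Nat using (ℕ; zero; suc; _+_; _*_; _≤_; _≥_; z≤n)
open import Data.Nat.Properties
  using (≤-refl; ≤-trans; +-mono-≤; m≤m+n; m≤n+m; +-assoc; +-identityʳ; ≤ᵇ⇒≤; ≤⇒≤ᵇ;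
         module ≤-Reasoning; +-*-semiring)
open import Algebra.Properties.Semiring.Sum +-*-semiring
  using (sum; sum-syntax; sum-cong-≗; *-distribˡ-sum; *-distribʳ-sum)
open import Data.Bool using (Bool; true; false; _∧_; T)
import Data.Bool as Bool
open import Data.Bool.Properties using (T-≡; T-∨; T-∧)
open import Data.Sum using (_⊎_; inj₁; inj₂; map₂)
open import Data.Empty using (⊥-elim)
open import Data.Fin using (Fin; remQuot; combine; _↑ˡ_; _↑ʳ_)
import Data.Fin as Fin
open import Data.Fin.Properties using (remQuot-combine; combine-remQuot)
open import Data.List using (length; filter; tabulate)
open import Data.Product using (∃; _,_; uncurry; map)
open import Function using (_∘_; id; Equivalence)
open import Relation.Binary.PropositionalEquality
  using (_≡_; refl; sym; trans; cong; cong₂; subst; module ≡-Reasoning)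

private
  variable
    m m′ : ℕ

sum-mono-≤ : (f g : Fin m → ℕ) → (∀ i → f i ≤ g i) → sum f ≤ sum g
sum-mono-≤ {zero}  f g f≤g = z≤n
sum-mono-≤ {suc m} f g f≤g =
  +-mono-≤ (f≤g Fin.zero) (sum-mono-≤ (f ∘ Fin.suc) (g ∘ Fin.suc) (f≤g ∘ Fin.suc))

term≤sum : (f : Fin m → ℕ) (i : Fin m) → f i ≤ sum f
term≤sum f Fin.zero    = m≤m+n _ _
term≤sum f (Fin.suc i) = ≤-trans (term≤sum (f ∘ Fin.suc) i) (m≤n+m _ _)

sum-↑ : (f : Fin (m + m′) → ℕ) → sum f ≡ sum (f ∘ (_↑ˡ m′)) + sum (f ∘ (m ↑ʳ_))
sum-↑ {zero}  f = refl
sum-↑ {suc m} f = trans (cong (f Fin.zero +_) (sum-↑ {m} (f ∘ Fin.suc)))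
                        (sym (+-assoc (f Fin.zero) _ _))

sum-combine : (f : Fin (m * m′) → ℕ) → sum f ≡ ∑[ i < m ] ∑[ j < m′ ] f (combine i j)
sum-combine {zero}      f = refl
sum-combine {suc m} {m′} f =
  trans (sum-↑ {m′} f) (cong (sum (f ∘ (_↑ˡ (m * m′))) +_) (sum-combine {m} (f ∘ (m′ ↑ʳ_))))

indicator : Bool → ℕ
indicator true  = 1
indicator false = 0

indicator-∧ : ∀ a b → indicator (a ∧ b) ≡ indicator a * indicator b
indicator-∧ true  b = sym (+-identityʳ (indicator b))
indicator-∧ false b = refl

indicator-mono : ∀ a b → (T a → T b) → indicator a ≤ indicator b
indicator-mono false b     _   = z≤n
indicator-mono true  true  _   = ≤-refl
indicator-mono true  false a⇒b = ⊥-elim (a⇒b _)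

count-tabulate : ∀ {M} (P : Fin M → Bool) (f : Fin m → Fin M) →
  length (filter (λ v → P v Bool.≟ true) (tabulate f)) ≡ ∑[ i < m ] indicator (P (f i))
count-tabulate {zero}  P f = refl
count-tabulate {suc m} P f with P (f Fin.zero)
... | true  = cong suc (count-tabulate P (f ∘ Fin.suc))
... | false = count-tabulate P (f ∘ Fin.suc)

count≡sum : (P : Fin m → Bool) → count P ≡ ∑[ i < m ] indicator (P i)
count≡sum P = count-tabulate P id

count-mono : (P Q : Fin m → Bool) → (∀ i → T (P i) → T (Q i)) → count P ≤ count Q
count-mono P Q P⇒Q = begin
  count P                        ≡⟨ count≡sum P ⟩
  ∑[ i < _ ] indicator (P i)     ≤⟨ sum-mono-≤ _ _ (λ i → indicator-mono (P i) (Q i) (P⇒Q i)) ⟩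
  ∑[ i < _ ] indicator (Q i)     ≡⟨ count≡sum Q ⟨
  count Q                        ∎
  where open ≤-Reasoning

indicator≤count : (P : Fin m → Bool) (i : Fin m) → indicator (P i) ≤ count P
indicator≤count P i = subst (indicator (P i) ≤_) (sym (count≡sum P)) (term≤sum (indicator ∘ P) i)

module _ {m m′ : ℕ} (Q : Fin (m * m′) → Bool) where

  cell : Fin m → Fin m′ → Bool
  cell i j = Q (combine i j)

  count-combine : count Q ≡ ∑[ i < m ] count (cell i)
  count-combine = begin
    count Q                                         ≡⟨ count≡sum Q ⟩
    sum (indicator ∘ Q)                             ≡⟨ sum-combine {m} (indicator ∘ Q) ⟩
    ∑[ i < m ] ∑[ j < m′ ] indicator (cell i j)     ≡⟨ sum-cong-≗ (λ i → sym (count≡sum (cell i))) ⟩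
    ∑[ i < m ] count (cell i)                       ∎
    where open ≡-Reasoning

  count-row≤count : (i : Fin m) → count (cell i) ≤ count Q
  count-row≤count i = subst (count (cell i) ≤_) (sym count-combine) (term≤sum _ i)

  count-column≤count : (j : Fin m′) → count (λ i → cell i j) ≤ count Q
  count-column≤count j = begin
    count (λ i → cell i j)                 ≡⟨ count≡sum (λ i → cell i j) ⟩
    ∑[ i < m ] indicator (cell i j)        ≤⟨ sum-mono-≤ _ _ (λ i → indicator≤count (cell i) j) ⟩
    ∑[ i < m ] count (cell i)              ≡⟨ count-combine ⟨
    count Q                                ∎
    where open ≤-Reasoning

  count-combine-∧ : (P : Fin m → Bool) (P′ : Fin m′ → Bool) →
    (∀ i j → cell i j ≡ P i ∧ P′ j) → count Q ≡ count P * count P′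
  count-combine-∧ P P′ cell≡P∧P′ = begin
    count Q                                                    ≡⟨ count-combine ⟩
    ∑[ i < m ] count (cell i)                                  ≡⟨ sum-cong-≗ (λ i → count≡sum (cell i)) ⟩
    ∑[ i < m ] ∑[ j < m′ ] indicator (cell i j)                ≡⟨ sum-cong-≗ (λ i → sum-cong-≗ (indicator-cell i)) ⟩
    ∑[ i < m ] ∑[ j < m′ ] (indicator (P i) * indicator (P′ j))
                                                               ≡⟨ sum-cong-≗ (λ i → sym (*-distribˡ-sum (indicator (P i)) (indicator ∘ P′))) ⟩
    ∑[ i < m ] (indicator (P i) * ∑[ j < m′ ] indicator (P′ j))
                                                               ≡⟨ sym (*-distribʳ-sum (sum (indicator ∘ P′)) (indicator ∘ P)) ⟩
    (∑[ i < m ] indicator (P i)) * ∑[ j < m′ ] indicator (P′ j)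
                                                               ≡⟨ sym (cong₂ _*_ (count≡sum P) (count≡sum P′)) ⟩
    count P * count P′                                         ∎
    where
    open ≡-Reasoning
    indicator-cell : ∀ i j → indicator (cell i j) ≡ indicator (P i) * indicator (P′ j)
    indicator-cell i j = trans (cong indicator (cell≡P∧P′ i j)) (indicator-∧ (P i) (P′ j))

module _ (k : ℕ) (G : Graph) (S : VSet G) where

  blackNeighbours : ℕ → Fin (n G) → ℕ
  blackNeighbours t v = count (λ u → adj G v u ∧ black k G S t u)

  black-suc : ∀ t v → T (black k G S t v) → T (black k G S (suc t) v)
  black-suc t v = Equivalence.from T-∨ ∘ inj₁

  black-threshold : ∀ t v → k ≤ blackNeighbours t v → T (black k G S (suc t) v)
  black-threshold t v = Equivalence.from T-∨ ∘ inj₂ ∘ ≤⇒≤ᵇ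

  black-step : ∀ t v → T (black k G S (suc t) v) → T (black k G S t v) ⊎ k ≤ blackNeighbours t v
  black-step t v = map₂ (≤ᵇ⇒≤ k _) ∘ Equivalence.to T-∨

module _ (G H : Graph) where

  pair : Fin (n G) → Fin (n H) → Fin (n (G □ H))
  pair = combine

  adj-pair : ∀ u v u′ v′ → adj (G □ H) (pair u v) (pair u′ v′) ≡ ×-adj G H (u , v) (u′ , v′)
  adj-pair u v u′ v′ = cong₂ (×-adj G H) (remQuot-combine u v) (remQuot-combine u′ v′)

  adj-pairˡ : ∀ {u u′} v → T (adj G u u′) → T (adj (G □ H) (pair u v) (pair u′ v))
  adj-pairˡ {u} {u′} v uu′ rewrite adj-pair u v u′ v | ==-refl v | adj-irrefl H v =
    Equivalence.from T-∨ (inj₂ uu′)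

  adj-pairʳ : ∀ u {v v′} → T (adj H v v′) → T (adj (G □ H) (pair u v) (pair u v′))
  adj-pairʳ u {v} {v′} vv′ rewrite adj-pair u v u v′ | ==-refl u =
    Equivalence.from T-∨ (inj₁ vv′)

  _⊠_ : VSet G → VSet H → VSet (G □ H)
  (S ⊠ S′) x = uncurry (λ u v → S u ∧ S′ v) (remQuot (n H) x)

  ⊠-pair : ∀ S S′ u v → (S ⊠ S′) (pair u v) ≡ S u ∧ S′ v
  ⊠-pair S S′ u v = cong (uncurry (λ u v → S u ∧ S′ v)) (remQuot-combine u v)

  ∣⊠∣ : ∀ S S′ → count (S ⊠ S′) ≡ count S * count S′
  ∣⊠∣ S S′ = count-combine-∧ (S ⊠ S′) S S′ (⊠-pair S S′)

  module _ (k : ℕ) (S : VSet G) (S′ : VSet H) where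

    private
      B : ℕ → Fin (n (G □ H)) → Bool
      B = black k (G □ H) (S ⊠ S′)

    blackNeighbours-pairˡ : ∀ t s u v → (∀ u′ → T (black k G S t u′) → T (B s (pair u′ v))) →
      blackNeighbours k G S t u ≤ blackNeighbours k (G □ H) (S ⊠ S′) s (pair u v)
    blackNeighbours-pairˡ t s u v lift = ≤-trans
      (count-mono _ _ λ u′ → Equivalence.from T-∧ ∘ map (adj-pairˡ v) (lift u′) ∘ Equivalence.to T-∧)
      (count-column≤count {n G} (λ y → adj (G □ H) (pair u v) y ∧ B s y) v)

    blackNeighbours-pairʳ : ∀ t s u v → (∀ v′ → T (black k H S′ t v′) → T (B s (pair u v′))) →
      blackNeighbours k H S′ t v ≤ blackNeighbours k (G □ H) (S ⊠ S′) s (pair u v)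
    blackNeighbours-pairʳ t s u v lift = ≤-trans
      (count-mono _ _ λ v′ → Equivalence.from T-∧ ∘ map (adj-pairʳ u) (lift v′) ∘ Equivalence.to T-∧)
      (count-row≤count {n G} (λ y → adj (G □ H) (pair u v) y ∧ B s y) u)

    black-⊠ : ∀ t t′ u v → T (black k G S t u) → T (black k H S′ t′ v) → T (B (t + t′) (pair u v))
    black-⊠ zero zero u v Su S′v =
      subst T (sym (⊠-pair S S′ u v)) (Equivalence.from T-∧ (Su , S′v))
    black-⊠ (suc t) t′ u v Btu B′t′v with black-step k G S t u Btu
    ... | inj₁ Btu′ = black-suc k (G □ H) (S ⊠ S′) (t + t′) (pair u v) (black-⊠ t t′ u v Btu′ B′t′v)
    ... | inj₂ k≤ = black-threshold k (G □ H) (S ⊠ S′) (t + t′) (pair u v) (≤-trans k≤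
          (blackNeighbours-pairˡ t (t + t′) u v (λ u′ Btu′ → black-⊠ t t′ u′ v Btu′ B′t′v)))
    black-⊠ zero (suc t′) u v Su B′t′v with black-step k H S′ t′ v B′t′v
    ... | inj₁ B′t′v′ = black-suc k (G □ H) (S ⊠ S′) t′ (pair u v) (black-⊠ zero t′ u v Su B′t′v′)
    ... | inj₂ k≤ = black-threshold k (G □ H) (S ⊠ S′) t′ (pair u v) (≤-trans k≤
          (blackNeighbours-pairʳ t′ t′ u v (λ v′ B′t′v′ → black-⊠ zero t′ u v′ Su B′t′v′)))

    ⊠-isConversionSet : IsConversionSet k G S → IsConversionSet k H S′ →
                        IsConversionSet k (G □ H) (S ⊠ S′)
    ⊠-isConversionSet convS convS′ x =
      subst (λ y → ∃ λ t → B t y ≡ true) (combine-remQuot {n G} (n H) x) (uncurry reach (remQuot (n H) x))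
      where
      reach : ∀ u v → ∃ λ t → B t (pair u v) ≡ true
      reach u v =
        let t , Btu = convS u ; t′ , B′t′v = convS′ v
        in t + t′ , Equivalence.to T-≡
             (black-⊠ t t′ u v (Equivalence.from T-≡ Btu) (Equivalence.from T-≡ B′t′v))

theorem3 : (G H : Graph) (k : ℕ) → k ≥ 1 →
    (a b c : ℕ) → IsMinConv k G a → IsMinConv k H b → IsMinConv k (G □ H) c →
    c ≤ a * b
-- The bound holds for k = 0 too.
theorem3 G H k _ a b c ((S , convS , ∣S∣≡a) , _) ((S′ , convS′ , ∣S′∣≡b) , _) (_ , c-minimal) =
  subst (c ≤_) (trans (∣⊠∣ G H S S′) (cong₂ _*_ ∣S∣≡a ∣S′∣≡b))
    (c-minimal (_⊠_ G H S S′) (⊠-isConversionSet G H k S S′ convS convS′))
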